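{- In every modal model (as defined in the context) and for all concepts $A,B,C$, each of the following fourteen inferences with two apodictic premises is valid: (Barbara) $N(BaA),N(CaB)\vdash N(CaA)$; (Celarent) $N(BeA),N(CaB)\vdash N(CeA)$; (Darii) $N(BaA),N(CiB)\vdash N(CiA)$; (Ferio) $N(BeA),N(CiB)\vdash N(CoA)$; (Cesare) $N(BeA),N(CaA)\vdash N(CeB)$; (Camestres) $N(BaA),N(CeA)\vdash N(CeB)$; (Festino) $N(BeA),N(CiA)\vdash N(CoB)$; (Baroco) $N(BaA),N(CoA)\vdash N(CoB)$; (Darapti) $N(CaA),N(CaB)\vdash N(BiA)$ provided $C$ is nonempty; (Felapton) $N(CeA),N(CaB)\vdash N(BoA)$ provided $C$ is nonempty; (Datisi) $N(CaA),N(CiB)\vdash N(BiA)$; (Disamis) $N(CiA),N(CaB)\vdash N(BiA)$; (Ferison) $N(CeA),N(CiB)\vdash N(BoA)$; (Bocardo) $N(CoA),N(CaB)\vdash N(BoA)$.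
   Context: A modal model consists of: a set $T$ with a distinguished element $t_0\in T$; for each $t\in T$ a set $W_t$; a collection of concepts, where a concept $A$ is a family $(A_t)_{t\in T}$ with $A_t\subseteq W_t$; and a set $I$ of individuals, where an individual $x$ is a function on $T$ with $x_t\in W_t$. Quantifiers range over $I$; a concept $C$ is nonempty if $\exists x\, Cx$. Interpretation: $Ax$ iff $x_{t_0}\in A_{t_0}$; $N(Ax)$ iff $x_t\in A_t$ for all $t$; $N(x\neq y)$ iff $x_t\neq y_t$ for all $t$. Apodictic relations: $N(BaA):\iff\forall x(Bx\Rightarrow N(Ax))$; $N(BeA):\iff\forall x[Bx\Rightarrow\forall y(Ay\Rightarrow N(x\neq y))]$; $N(BiA):\iff\exists x(Bx\wedge N(Ax))\vee\exists x(N(Bx)\wedge Ax)$; $N(BoA):\iff\exists x[Bx\wedge\forall y(Ay\Rightarrow N(x\neq y))]\vee\exists x[N(Bx)\wedge\neg Ax\wedge\forall y(N(Ay)\Rightarrow N(x\neq y))]$. -}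

module Defs where

open import Data.Product using (Σ; _×_; _,_)
open import Data.Sum using (_⊎_)
open import Relation.Nullary using (¬_)
open import Relation.Binary.PropositionalEquality using (_≡_)

-- A modal model: index set T with distinguished t₀, sets W t,
-- a collection of concepts (families A t ⊆ W t, subsets as predicates),
-- and a set I of individuals (functions x with x t ∈ W t).
record ModalModel : Set₂ where
  field
    T         : Set
    t₀        : T
    W         : T → Set
    isConcept : ((t : T) → W t → Set) → Set
    isInd     : ((t : T) → W t) → Set

  Concept : Set₁
  Concept = (t : T) → W t → Set

  Fn : Set
  Fn = (t : T) → W t

  -- quantifiers range over the individuals I
  Individual : Set
  Individual = Σ Fn isInd

  val : Individual → Fn
  val (x , _) = x

  _∋_ : Concept → Individual → Set
  A ∋ x = A t₀ (val x t₀)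

  N∋ : Concept → Individual → Set
  N∋ A x = (t : T) → A t (val x t)

  N≢ : Individual → Individual → Set
  N≢ x y = (t : T) → ¬ (val x t ≡ val y t)

  Nonempty : Concept → Set
  Nonempty C = Σ Individual λ x → C ∋ x

  -- apodictic relations; NaR B A is N(BaA), etc.
  Na : Concept → Concept → Set
  Na B A = (x : Individual) → B ∋ x → N∋ A x

  Ne : Concept → Concept → Set
  Ne B A = (x : Individual) → B ∋ x → (y : Individual) → A ∋ y → N≢ x y

  Ni : Concept → Concept → Set
  Ni B A = (Σ Individual λ x → B ∋ x × N∋ A x)
         ⊎ (Σ Individual λ x → N∋ B x × A ∋ x)

  No : Concept → Concept → Set
  No B A = (Σ Individual λ x → B ∋ x × ((y : Individual) → A ∋ y → N≢ x y))
         ⊎ (Σ Individual λ x → N∋ B x × ¬ (A ∋ x)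
                            × ((y : Individual) → N∋ A y → N≢ x y))

{-# OPTIONS --safe #-}
-- All the moods reduce, as in Aristotle, to Barbara, Celarent, Darii and
-- Ferio by converting e- and i-premises, which are symmetric, and by
-- subalternation N(CaB) ⊢ N(CiB) for a nonempty subject C. The only modal
-- facts needed are that necessity implies actuality (evaluate at t₀) and
-- that N(x ≠ y) is symmetric; nothing about which families are concepts is
-- used. Baroco and Bocardo are checked directly.
module Submission where

open import Defs
open import Data.Product using (_×_; _,_)
open import Data.Sum using (inj₁; inj₂)
open import Relation.Binary.PropositionalEquality using (sym)

module Syllogisms (M : ModalModel) where

  open ModalModel M

  -- Concepts are explicit arguments: Na, Ne, Ni and No unfold, so Agda
  -- cannot infer them from the premises.

  N≢-sym : ∀ x y → N≢ x y → N≢ y x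
  N≢-sym _ _ x≢y t y≡x = x≢y t (sym y≡x)

  Ne-sym : ∀ B A → Ne B A → Ne A B
  Ne-sym _ _ be y Ay x Bx = N≢-sym x y (be x Bx y Ay)

  Ni-sym : ∀ B A → Ni B A → Ni A B
  Ni-sym _ _ (inj₁ (x , Bx , nA)) = inj₂ (x , nA , Bx)
  Ni-sym _ _ (inj₂ (x , nB , Ax)) = inj₁ (x , Ax , nB)

  Na⇒Ni : ∀ C B → Nonempty C → Na C B → Ni C B
  Na⇒Ni _ _ (x , Cx) cb = inj₁ (x , Cx , cb x Cx)

  barbara : ∀ A B C → Na B A → Na C B → Na C A
  barbara _ _ _ ba cb x Cx = ba x (cb x Cx t₀)

  celarent : ∀ A B C → Ne B A → Na C B → Ne C A
  celarent _ _ _ be cb x Cx = be x (cb x Cx t₀)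

  darii : ∀ A B C → Na B A → Ni C B → Ni C A
  darii _ _ _ ba (inj₁ (x , Cx , nB)) = inj₁ (x , Cx , ba x (nB t₀))
  darii _ _ _ ba (inj₂ (x , nC , Bx)) = inj₁ (x , nC t₀ , ba x Bx)

  ferio : ∀ A B C → Ne B A → Ni C B → No C A
  ferio _ _ _ be (inj₁ (x , Cx , nB)) = inj₁ (x , Cx , be x (nB t₀))
  ferio _ _ _ be (inj₂ (x , nC , Bx)) = inj₁ (x , nC t₀ , be x Bx)

  cesare : ∀ A B C → Ne B A → Na C A → Ne C B
  cesare A B C be ca = celarent B A C (Ne-sym B A be) ca

  camestres : ∀ A B C → Na B A → Ne C A → Ne C B
  camestres A B C ba ce = Ne-sym B C (celarent C A B (Ne-sym C A ce) ba)

  festino : ∀ A B C → Ne B A → Ni C A → No C B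
  festino A B C be ci = ferio B A C (Ne-sym B A be) ci

  baroco : ∀ A B C → Na B A → No C A → No C B
  baroco _ _ _ ba (inj₁ (x , Cx , x≢A)) =
    inj₁ (x , Cx , λ y By → x≢A y (ba y By t₀))
  baroco _ _ _ ba (inj₂ (x , nC , _ , x≢nA)) =
    inj₁ (x , nC t₀ , λ y By → x≢nA y (ba y By))

  datisi : ∀ A B C → Na C A → Ni C B → Ni B A
  datisi A B C ca ci = darii A C B ca (Ni-sym C B ci)

  disamis : ∀ A B C → Ni C A → Na C B → Ni B A
  disamis A B C ci cb = Ni-sym A B (darii B C A cb (Ni-sym C A ci))

  ferison : ∀ A B C → Ne C A → Ni C B → No B A
  ferison A B C ce ci = ferio A C B ce (Ni-sym C B ci)

  darapti : ∀ A B C → Nonempty C → Na C A → Na C B → Ni B A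
  darapti A B C ne ca cb = datisi A B C ca (Na⇒Ni C B ne cb)

  felapton : ∀ A B C → Nonempty C → Ne C A → Na C B → No B A
  felapton A B C ne ce cb = ferison A B C ce (Na⇒Ni C B ne cb)

  bocardo : ∀ A B C → No C A → Na C B → No B A
  bocardo _ _ _ (inj₁ (x , Cx , x≢A)) cb = inj₁ (x , cb x Cx t₀ , x≢A)
  bocardo _ _ _ (inj₂ (x , nC , ¬Ax , x≢nA)) cb = inj₂ (x , cb x (nC t₀) , ¬Ax , x≢nA)

mainTheorem5 : (M : ModalModel) → let open ModalModel M in
    (A B C : Concept) → isConcept A → isConcept B → isConcept C →
      -- Barbara
      (Na B A → Na C B → Na C A)
      -- Celarent
    × (Ne B A → Na C B → Ne C A)
      -- Darii
    × (Na B A → Ni C B → Ni C A)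
      -- Ferio
    × (Ne B A → Ni C B → No C A)
      -- Cesare
    × (Ne B A → Na C A → Ne C B)
      -- Camestres
    × (Na B A → Ne C A → Ne C B)
      -- Festino
    × (Ne B A → Ni C A → No C B)
      -- Baroco
    × (Na B A → No C A → No C B)
      -- Darapti (C nonempty)
    × (Nonempty C → Na C A → Na C B → Ni B A)
      -- Felapton (C nonempty)
    × (Nonempty C → Ne C A → Na C B → No B A)
      -- Datisi
    × (Na C A → Ni C B → Ni B A)
      -- Disamis
    × (Ni C A → Na C B → Ni B A)
      -- Ferison
    × (Ne C A → Ni C B → No B A)
      -- Bocardo
    × (No C A → Na C B → No B A)
mainTheorem5 M A B C _ _ _ =
    barbara A B C , celarent A B C , darii A B C , ferio A B C
  , cesare A B C , camestres A B C , festino A B C , baroco A B C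
  , darapti A B C , felapton A B C , datisi A B C , disamis A B C
  , ferison A B C , bocardo A B C
  where open Syllogisms M
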